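{- Let $D$ be a connected digraph and let $(D,X,H,f)$ be an uncolorable degree-feasible configuration. Then: (a) $f(X_u)=d_D(u)$ for all $u\in V(D)$; (b) if $v\in V(D)$ is not a separating vertex of $D$, $x_v\in X_v$ satisfies $f(x_v)\ne(0,0)$, and $u\in V(D)\setminus\{v\}$, then $f^+(x)\ge a_H(x,x_v)$ for all $x\in X_u$ and $\sum_{x\in X_u}a_H(x,x_v)=a_D(u,v)$; and $f^-(x)\ge a_H(x_v,x)$ for all $x\in X_u$ and $\sum_{x\in X_u}a_H(x_v,x)=a_D(v,u)$; (c) if $|D|\ge2$ and $u\in V(D)$, then there is a partial transversal $T$ of $(X,H)$ with $\mathrm{dom}(T:D)=V(D)\setminus\{u\}$ such that $H[T]$ is strictly $f$-degenerate; and for every such $T$ and every $x\in X_u$ we have $f(x)=d_{H[T\cup\{x\}]}(x)$.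
   Context: Digraphs are finite, without loops and parallel arcs (digons allowed); $d_D(v)=(d^+_D(v),d^-_D(v))$; pairs in $\mathbb{N}_0^2$ compared and added coordinatewise; $a_H(x,y)=1$ if $xy\in A(H)$, else $0$. Connected refers to the underlying graph; a separating vertex of connected $D$ is $v$ with $D-v$ having at least two components. Cover of $D$: pair $(X,H)$, $H$ disjoint from $D$, $X_v\subseteq V(H)$ pairwise disjoint with union $V(H)$, each independent, arcs from $X_u$ to $X_v$ ($u\ne v$) a matching if $uv\in A(D)$, none otherwise. Transversal: $|T\cap X_v|=1$ for all $v$; partial transversal: $|T\cap X_v|\le1$; $\mathrm{dom}(T:D)=\{v:X_v\cap T\ne\varnothing\}$. For $f:V(H)\to\mathbb{N}_0^2$, $f=(f^+,f^-)$, $f(Y)=\sum_{y\in Y}f(y)$; $H$ is strictly $f$-degenerate if every nonempty subdigraph $H''$ of $H$ has a vertex $x$ with $d^+_{H''}(x)<f^+(x)$ or $d^-_{H''}(x)<f^-(x)$. A configuration $(D,X,H,f)$: $(X,H)$ a cover of $D$, $f:V(H)\to\mathbb{N}_0^2$; degree-feasible if $f(X_v)\ge d_D(v)$ for all $v$; colorable if some transversal $T$ has $H[T]$ strictly $f$-degenerate; uncolorable otherwise. -}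

module Defs where

open import Data.Nat using (ℕ; zero; suc; _+_; _≤_; _<_)
open import Data.Bool using (Bool; true; false; if_then_else_; _∧_; _∨_)
open import Data.Fin using (Fin; zero; suc; _≟_)
open import Data.Product using (Σ; _×_; _,_; proj₁; proj₂; ∃)
open import Data.Sum using (_⊎_)
open import Relation.Nullary using (¬_)
open import Relation.Nullary.Decidable using (⌊_⌋)
open import Relation.Binary.PropositionalEquality using (_≡_; _≢_)
open import Relation.Binary.Construct.Closure.ReflexiveTransitive using (Star)

count : ∀ {m} → (Fin m → Bool) → ℕ
count {zero}  P = 0
count {suc m} P = (if P zero then 1 else 0) + count (λ i → P (suc i))

sumPairs : ∀ {m} → (Fin m → Bool) → (Fin m → ℕ × ℕ) → ℕ × ℕ
sumPairs {zero}  P g = (0 , 0)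
sumPairs {suc m} P g =
  let (a , b) = sumPairs (λ i → P (suc i)) (λ i → g (suc i)) in
  if P zero then (proj₁ (g zero) + a , proj₂ (g zero) + b) else (a , b)

sumN : ∀ {m} → (Fin m → Bool) → (Fin m → ℕ) → ℕ
sumN {zero}  P g = 0
sumN {suc m} P g = (if P zero then g zero else 0) + sumN (λ i → P (suc i)) (λ i → g (suc i))

_≤²_ : ℕ × ℕ → ℕ × ℕ → Set
(a , b) ≤² (c , d) = (a ≤ c) × (b ≤ d)

-- indicator a(x,y) of a Bool-valued arc relation
ind : Bool → ℕ
ind true  = 1
ind false = 0

-- Digraphs: vertex set Fin n, arc relation Bool-valued, loopless
-- (digons allowed, no parallel arcs automatically).

record Digraph : Set where
  field
    n        : ℕ
    arc      : Fin n → Fin n → Bool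
    loopless : ∀ v → arc v v ≡ false
open Digraph public

deg : (D : Digraph) → Fin (n D) → ℕ × ℕ
deg D v = (count (λ w → arc D v w) , count (λ w → arc D w v))

Adj : (D : Digraph) → Fin (n D) → Fin (n D) → Set
Adj D u w = (arc D u w ≡ true) ⊎ (arc D w u ≡ true)

Connected : Digraph → Set
Connected D = ∀ u w → Star (Adj D) u w

AdjWithout : (D : Digraph) → Fin (n D) → Fin (n D) → Fin (n D) → Set
AdjWithout D v a b = Adj D a b × a ≢ v × b ≢ v

Separating : (D : Digraph) → Fin (n D) → Set
Separating D v =
  Σ (Fin (n D)) λ a → Σ (Fin (n D)) λ b →
    a ≢ v × b ≢ v × ¬ Star (AdjWithout D v) a b

-- Covers. H has vertex set Fin m; p x = v means x ∈ X_v
-- (so the X_v partition V(H)).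

record Cover (D : Digraph) : Set where
  field
    m         : ℕ
    harc      : Fin m → Fin m → Bool
    hloopless : ∀ x → harc x x ≡ false
    p         : Fin m → Fin (n D)
    indep     : ∀ x y → p x ≡ p y → harc x y ≡ false
    noArc     : ∀ x y → harc x y ≡ true → arc D (p x) (p y) ≡ true
    matchOut  : ∀ x y y' → harc x y ≡ true → harc x y' ≡ true → p y ≡ p y' → y ≡ y'
    matchIn   : ∀ x x' y → harc x y ≡ true → harc x' y ≡ true → p x ≡ p x' → x ≡ x'
open Cover public

module _ {D : Digraph} (C : Cover D) where

  inX : Fin (n D) → Fin (m C) → Bool
  inX v x = ⌊ p C x ≟ v ⌋

  countIn : (Fin (m C) → Bool) → Fin (n D) → ℕ
  countIn T v = count (λ x → T x ∧ inX v x)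

  Transversal : (Fin (m C) → Bool) → Set
  Transversal T = ∀ v → countIn T v ≡ 1

  PartialTransversal : (Fin (m C) → Bool) → Set
  PartialTransversal T = ∀ v → countIn T v ≤ 1

  DomAllBut : (Fin (m C) → Bool) → Fin (n D) → Set
  DomAllBut T u = ∀ v → (1 ≤ countIn T v → v ≢ u) × (v ≢ u → 1 ≤ countIn T v)

  StrictlyDegenerate : (Fin (m C) → ℕ × ℕ) → (Fin (m C) → Bool) → Set
  StrictlyDegenerate f T =
    (S : Fin (m C) → Bool) (R : Fin (m C) → Fin (m C) → Bool) →
    (∀ x → S x ≡ true → T x ≡ true) →
    (∀ x y → R x y ≡ true → (harc C x y ≡ true) × (S x ≡ true) × (S y ≡ true)) →
    (∃ λ x → S x ≡ true) →
    ∃ λ x → (S x ≡ true) ×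
      ((count (λ y → R x y) < proj₁ (f x)) ⊎ (count (λ y → R y x) < proj₂ (f x)))

  fX : (Fin (m C) → ℕ × ℕ) → Fin (n D) → ℕ × ℕ
  fX f v = sumPairs (inX v) f

  DegreeFeasible : (Fin (m C) → ℕ × ℕ) → Set
  DegreeFeasible f = ∀ v → deg D v ≤² fX f v

  Colorable : (Fin (m C) → ℕ × ℕ) → Set
  Colorable f = ∃ λ T → Transversal T × StrictlyDegenerate f T

  Uncolorable : (Fin (m C) → ℕ × ℕ) → Set
  Uncolorable f = ¬ Colorable f

  degIn : (Fin (m C) → Bool) → Fin (m C) → ℕ × ℕ
  degIn S x = (count (λ y → S y ∧ harc C x y) , count (λ y → S y ∧ harc C y x))

  addV : (Fin (m C) → Bool) → Fin (m C) → Fin (m C) → Bool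
  addV T x y = T y ∨ ⌊ y ≟ x ⌋

{-# OPTIONS --safe #-}
-- Colour greedily. Call w slack for a partial colouring T₀ and a set Q of uncoloured vertices if,
-- in one of the two directions, the residual capacity Σ_{y ∈ X_w} (f(y) − d_{T₀}(y)) exceeds the
-- number of arcs between w and Q. If every nonempty Q′ ⊆ Q contains a vertex slack for T₀ and Q′,
-- then T₀ extends over Q: colour Q − w first, for a slack w, and then some y ∈ X_w still has degree
-- below f(y), because the arcs between two classes form a matching. By degree-feasibility a vertex
-- of Q′ is slack as soon as it has an arc to a vertex outside Q′ whose class T₀ does not meet, so
-- along paths of D only Q′ = Q can fail. (a): if f(X_u) > d(u) then u is slack for ∅ and V(D), so
-- D would be colourable. (c): for Q = V(D) − u connectivity yields a partial colouring T; if some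
-- x ∈ X_u had a coordinate of d_T(x) below f(x), then T + x would colour D, and summing d_T(x) ≥ f(x)
-- over X_u against (a) forces equality. (b): start from T₀ = {x_v}, strictly f-degenerate since
-- f(x_v) ≠ 0; as D − v is connected, uncolourability says exactly that no u ≠ v is slack.
module Submission where

open import Defs
open import Data.Nat using (ℕ; zero; suc; pred; _+_; _∸_; _≤_; _<_; z≤n; s≤s; s≤s⁻¹; z<s; _≤?_; _<?_)
open import Data.Nat.Properties
  using ( ≤-refl; ≤-reflexive; ≤-trans; ≤-antisym; <⇒≤; <⇒≢; <⇒≱; ≮⇒≥; ≰⇒>; ≤∧≮⇒≡; <-irrefl
        ; <-≤-trans; ≤-<-trans; n≤1+n; m≤n⇒m≤1+n; n≤0⇒n≡0; n≮0; m≤m+n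
        ; +-comm; +-suc; +-identityʳ; +-commutativeSemigroup
        ; +-mono-≤; +-monoˡ-≤; +-monoʳ-≤; +-mono-<-≤; +-mono-≤-<; +-cancelˡ-<; +-cancelʳ-≤
        ; m≤n+m∸n; m≤o∸n⇒m+n≤o; m∸n≢0⇒n<m; module ≤-Reasoning )
open import Data.Bool using (Bool; true; false; _∧_; _∨_; not; if_then_else_)
open import Data.Bool.Properties
  using (∧-distribʳ-∨; ∧-zeroʳ; ∨-identityʳ; ∨-assoc; ∨-comm; ∨-inverseˡ) renaming (_≟_ to _≟ᵇ_)
open import Data.Fin using (Fin; zero; suc; _≟_)
open import Data.Fin.Properties using (any?; suc-injective; 0≢1+n)
open import Data.Product using (_×_; _,_; proj₁; proj₂; ∃)
open import Data.Sum using (_⊎_; inj₁; inj₂)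
import Data.Sum as Sum
open import Data.Empty using (⊥; ⊥-elim)
open import Function using (_∘_)
open import Relation.Nullary using (¬_; Dec; yes; no; contradiction)
open import Relation.Nullary.Decidable
  using (⌊_⌋; isYes≗does; dec-true; dec-false; ⌊⌋-map′; _×-dec_; _⊎-dec_)
open import Relation.Binary.PropositionalEquality
  using (_≡_; _≢_; refl; sym; trans; cong; cong₂; subst; subst₂; module ≡-Reasoning)
open import Relation.Binary.Construct.Closure.ReflexiveTransitive using (Star; ε; _◅_)
open import Algebra.Properties.CommutativeSemigroup +-commutativeSemigroup using (interchange; x∙yz≈y∙xz)

-- Finite sets as Boolean predicates

BSet : ℕ → Set
BSet k = Fin k → Bool

module _ {k : ℕ} where

  infix  4 _∈_ _∉_ _⊆_
  infixr 7 _∩_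
  infixr 6 _∪_

  ∅ full : BSet k
  ∅ _ = false
  full _ = true

  ｛_｝ : Fin k → BSet k
  ｛ x ｝ i = ⌊ i ≟ x ⌋

  ∁ : BSet k → BSet k
  ∁ P i = not (P i)

  _∪_ _∩_ : BSet k → BSet k → BSet k
  (P ∪ Q) i = P i ∨ Q i
  (P ∩ Q) i = P i ∧ Q i

  _∈_ _∉_ : Fin k → BSet k → Set
  i ∈ P = P i ≡ true
  i ∉ P = P i ≡ false

  _⊆_ Disjoint : BSet k → BSet k → Set
  P ⊆ Q = ∀ i → i ∈ P → i ∈ Q
  Disjoint P Q = ∀ i → i ∈ P → i ∈ Q → ⊥

-- Stated for the Boolean P i rather than for i ∈ P, since Agda cannot infer P from P i ≡ true.

∈∉⇒⊥ : ∀ {b} → b ≡ true → b ≡ false → ⊥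
∈∉⇒⊥ refl ()

¬∈⇒∉ : ∀ {b} → ¬ b ≡ true → b ≡ false
¬∈⇒∉ {true}  b≢true = contradiction refl b≢true
¬∈⇒∉ {false} _      = refl

∉⇒∈∁ : ∀ {b} → b ≡ false → not b ≡ true
∉⇒∈∁ = cong not

∈∁⇒∉ : ∀ {b} → not b ≡ true → b ≡ false
∈∁⇒∉ {false} _ = refl

∈-∩ : ∀ {a b} → a ≡ true → b ≡ true → a ∧ b ≡ true
∈-∩ = cong₂ _∧_

∈-∩⁻ : ∀ {a b} → a ∧ b ≡ true → a ≡ true × b ≡ true
∈-∩⁻ {true} {true} _ = refl , refl

x∈｛x｝ : ∀ {k} {x : Fin k} → x ∈ ｛ x ｝
x∈｛x｝ {x = x} = trans (isYes≗does (x ≟ x)) (dec-true (x ≟ x) refl)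

≢⇒∉｛｝ : ∀ {k} {i x : Fin k} → i ≢ x → i ∉ ｛ x ｝
≢⇒∉｛｝ {i = i} {x} i≢x = trans (isYes≗does (i ≟ x)) (dec-false (i ≟ x) i≢x)

∈｛｝⇒≡ : ∀ {k} {i x : Fin k} → i ∈ ｛ x ｝ → i ≡ x
∈｛｝⇒≡ {i = i} {x} i∈｛x｝ with i ≟ x
... | yes i≡x = i≡x

∈∁｛｝⇒≢ : ∀ {k} {i x : Fin k} → i ∈ ∁ ｛ x ｝ → i ≢ x
∈∁｛｝⇒≢ {x = x} i∈∁｛x｝ refl = ∈∉⇒⊥ x∈｛x｝ (∈∁⇒∉ i∈∁｛x｝)

｛｝-sym : ∀ {k} (i x : Fin k) → ⌊ i ≟ x ⌋ ≡ ⌊ x ≟ i ⌋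
｛｝-sym i x with i ≟ x
... | yes refl = sym (x∈｛x｝ {x = i})
... | no  i≢x  = sym (≢⇒∉｛｝ (i≢x ∘ sym))

∁｛｝-disjoint : ∀ {k} (x : Fin k) → Disjoint (∁ ｛ x ｝) ｛ x ｝
∁｛｝-disjoint x i i∈∁｛x｝ i∈｛x｝ = ∈∉⇒⊥ i∈｛x｝ (∈∁⇒∉ i∈∁｛x｝)

∁｛｝∩-∪｛｝ : ∀ {k} {x : Fin k} (Q : BSet k) → x ∈ Q → ∀ i → (∁ ｛ x ｝ ∩ Q ∪ ｛ x ｝) i ≡ Q i
∁｛｝∩-∪｛｝ {x = x} Q x∈Q i with i ≟ x
... | yes refl rewrite x∈Q = refl
... | no  i≢x  = ∨-identityʳ (Q i)

∈∪｛｝⇒∈ : ∀ {k} (T : BSet k) {y z : Fin k} → z ∈ T ∪ ｛ y ｝ → z ≢ y → z ∈ T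
∈∪｛｝⇒∈ T {z = z} z∈ z≢y =
  trans (sym (∨-identityʳ (T z))) (subst (λ b → T z ∨ b ≡ true) (≢⇒∉｛｝ z≢y) z∈)

-- Counting

ind≤1 : ∀ b → ind b ≤ 1
ind≤1 true  = ≤-refl
ind≤1 false = z≤n

0<ind⇒ : ∀ {b} → 0 < ind b → b ≡ true
0<ind⇒ {true} _ = refl

ind-∨ : ∀ a b → (a ∧ b ≡ true → ⊥) → ind (a ∨ b) ≡ ind a + ind b
ind-∨ true  true  a∧b = contradiction refl a∧b
ind-∨ true  false _   = refl
ind-∨ false b     _   = refl

if≡ind : ∀ b → (if b then 1 else 0) ≡ ind b
if≡ind true  = refl
if≡ind false = refl

count-cong : ∀ {k} {P Q : BSet k} → (∀ i → P i ≡ Q i) → count P ≡ count Q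
count-cong {zero}  P≗Q = refl
count-cong {suc k} P≗Q = cong₂ _+_ (cong (λ b → if b then 1 else 0) (P≗Q zero)) (count-cong (P≗Q ∘ suc))

count-∅ : ∀ {k} → count (∅ {k}) ≡ 0
count-∅ {zero}  = refl
count-∅ {suc k} = count-∅ {k}

count-mono : ∀ {k} {P Q : BSet k} → P ⊆ Q → count P ≤ count Q
count-mono {zero}          P⊆Q = z≤n
count-mono {suc k} {P} {Q} P⊆Q with P zero in P0 | Q zero in Q0
... | true  | true  = s≤s (count-mono (P⊆Q ∘ suc))
... | true  | false = ⊥-elim (∈∉⇒⊥ (P⊆Q zero P0) Q0)
... | false | true  = m≤n⇒m≤1+n (count-mono (P⊆Q ∘ suc))
... | false | false = count-mono (P⊆Q ∘ suc)

count-∪ : ∀ {k} (P Q : BSet k) → Disjoint P Q → count (P ∪ Q) ≡ count P + count Q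
count-∪ {zero}  P Q _     = refl
count-∪ {suc k} P Q P∩Q≡∅ with P zero in P0 | Q zero in Q0
... | true  | true  = ⊥-elim (P∩Q≡∅ zero P0 Q0)
... | true  | false = cong suc (count-∪ (P ∘ suc) (Q ∘ suc) (P∩Q≡∅ ∘ suc))
... | false | true  = trans (cong suc (count-∪ (P ∘ suc) (Q ∘ suc) (P∩Q≡∅ ∘ suc))) (sym (+-suc _ _))
... | false | false = count-∪ (P ∘ suc) (Q ∘ suc) (P∩Q≡∅ ∘ suc)

count-∪-≤ : ∀ {k} (P Q : BSet k) → count (P ∪ Q) ≤ count P + count Q
count-∪-≤ {zero}  P Q = z≤n
count-∪-≤ {suc k} P Q with P zero | Q zero
... | true  | true  =
  s≤s (≤-trans (count-∪-≤ (P ∘ suc) (Q ∘ suc)) (≤-trans (n≤1+n _) (≤-reflexive (sym (+-suc _ _)))))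
... | true  | false = s≤s (count-∪-≤ (P ∘ suc) (Q ∘ suc))
... | false | true  = ≤-trans (s≤s (count-∪-≤ (P ∘ suc) (Q ∘ suc))) (≤-reflexive (sym (+-suc _ _)))
... | false | false = count-∪-≤ (P ∘ suc) (Q ∘ suc)

count-∪∩ : ∀ {k} (P Q R : BSet k) → Disjoint P Q → count ((P ∪ Q) ∩ R) ≡ count (P ∩ R) + count (Q ∩ R)
count-∪∩ P Q R P∩Q≡∅ = trans (count-cong λ i → ∧-distribʳ-∨ (R i) (P i) (Q i))
  (count-∪ (P ∩ R) (Q ∩ R) λ i i∈P∩R i∈Q∩R → P∩Q≡∅ i (proj₁ (∈-∩⁻ i∈P∩R)) (proj₁ (∈-∩⁻ i∈Q∩R)))

count-split : ∀ {k} (P : BSet k) (x : Fin k) → count P ≡ ind (P x) + count (∁ ｛ x ｝ ∩ P)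
count-split {suc k} P zero    = cong (_+ count (P ∘ suc)) (if≡ind (P zero))
count-split {suc k} P (suc x) = begin
  head + count (P ∘ suc)                                ≡⟨ cong (head +_) (count-split (P ∘ suc) x) ⟩
  head + (ind (P (suc x)) + count (∁ ｛ x ｝ ∩ P ∘ suc))  ≡⟨ x∙yz≈y∙xz head (ind (P (suc x))) _ ⟩
  ind (P (suc x)) + (head + count (∁ ｛ x ｝ ∩ P ∘ suc))  ≡⟨ cong (λ c → ind (P (suc x)) + (head + c))
                                                                 (count-cong tail) ⟩
  ind (P (suc x)) + count (∁ ｛ suc x ｝ ∩ P)            ∎
  where
  open ≡-Reasoning
  head : ℕ
  head = if P zero then 1 else 0
  tail : ∀ i → not ⌊ i ≟ x ⌋ ∧ P (suc i) ≡ not ⌊ suc i ≟ suc x ⌋ ∧ P (suc i)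
  tail i = cong (λ b → not b ∧ P (suc i)) (sym (⌊⌋-map′ (cong suc) suc-injective (i ≟ x)))

count-remove : ∀ {k} (P : BSet k) {x : Fin k} → x ∈ P → count P ≡ suc (count (∁ ｛ x ｝ ∩ P))
count-remove P {x} x∈P = trans (count-split P x) (cong (λ b → ind b + count (∁ ｛ x ｝ ∩ P)) x∈P)

count-｛｝∩ : ∀ {k} (x : Fin k) (P : BSet k) → count (｛ x ｝ ∩ P) ≡ ind (P x)
count-｛｝∩ {k} x P = begin
  count (｛ x ｝ ∩ P)                                      ≡⟨ count-split (｛ x ｝ ∩ P) x ⟩
  ind (⌊ x ≟ x ⌋ ∧ P x) + count (∁ ｛ x ｝ ∩ ｛ x ｝ ∩ P)  ≡⟨ cong₂ _+_ (cong (λ b → ind (b ∧ P x)) x∈｛x｝)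
                                                                     (count-cong outside) ⟩
  ind (P x) + count (∅ {k})                               ≡⟨ cong (ind (P x) +_) (count-∅ {k}) ⟩
  ind (P x) + 0                                           ≡⟨ +-identityʳ _ ⟩
  ind (P x)                                               ∎
  where
  open ≡-Reasoning
  outside : ∀ i → not ⌊ i ≟ x ⌋ ∧ ⌊ i ≟ x ⌋ ∧ P i ≡ false
  outside i with ⌊ i ≟ x ⌋
  ... | true  = refl
  ... | false = refl

count-∪｛｝∩ : ∀ {k} (T B : BSet k) {x : Fin k} → x ∉ B → count ((T ∪ ｛ x ｝) ∩ B) ≡ count (T ∩ B)
count-∪｛｝∩ T B {x} x∉B = count-cong same
  where
  same : ∀ z → (T z ∨ ⌊ z ≟ x ⌋) ∧ B z ≡ T z ∧ B z
  same z with z ≟ x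
  ... | yes refl rewrite x∉B = trans (∧-zeroʳ _) (sym (∧-zeroʳ _))
  ... | no  z≢x  = cong (_∧ B z) (∨-identityʳ (T z))

0<count : ∀ {k} {P : BSet k} {x : Fin k} → x ∈ P → 0 < count P
0<count {P = P} x∈P rewrite count-remove P x∈P = z<s

count≡0⇒∉ : ∀ {k} {P : BSet k} → count P ≡ 0 → ∀ i → i ∉ P
count≡0⇒∉ {P = P} count≡0 i = ¬∈⇒∉ λ i∈P → <⇒≢ (0<count {P = P} i∈P) (sym count≡0)

count≢0⇒∃ : ∀ {k} (P : BSet k) → count P ≢ 0 → ∃ λ i → i ∈ P
count≢0⇒∃ {k} P count≢0 with any? (λ i → P i ≟ᵇ true)
... | yes found = found
... | no  none  = contradiction (trans (count-cong λ i → ¬∈⇒∉ λ i∈P → none (i , i∈P)) (count-∅ {k})) count≢0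

count≤1⇒≡ : ∀ {k} {P : BSet k} {i j : Fin k} → count P ≤ 1 → i ∈ P → j ∈ P → j ≡ i
count≤1⇒≡ {P = P} {i} {j} count≤1 i∈P j∈P with j ≟ i
... | yes j≡i = j≡i
... | no  j≢i = ⊥-elim (∈∉⇒⊥ (∈-∩ (∉⇒∈∁ (≢⇒∉｛｝ j≢i)) j∈P) (count≡0⇒∉ rest≡0 j))
  where
  rest≡0 : count (∁ ｛ i ｝ ∩ P) ≡ 0
  rest≡0 = n≤0⇒n≡0 (s≤s⁻¹ (subst (_≤ 1) (count-remove P i∈P) count≤1))

count-< : ∀ {k} {P Q : BSet k} {x : Fin k} → P ⊆ Q → x ∈ Q → x ∉ P → count P < count Q
count-< {P = P} {Q} {x} P⊆Q x∈Q x∉P rewrite count-remove Q x∈Q = s≤s (count-mono P⊆Q∖x)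
  where
  P⊆Q∖x : P ⊆ ∁ ｛ x ｝ ∩ Q
  P⊆Q∖x i i∈P = ∈-∩ (∉⇒∈∁ (≢⇒∉｛｝ λ { refl → ∈∉⇒⊥ i∈P x∉P })) (P⊆Q i i∈P)

count-image-≤ : ∀ {k l} {P : BSet k} {Q : BSet l} (g : Fin k → Fin l) →
  (∀ i → i ∈ P → g i ∈ Q) → (∀ i j → i ∈ P → j ∈ P → g i ≡ g j → i ≡ j) → count P ≤ count Q
count-image-≤ {zero}              g maps inj = z≤n
count-image-≤ {suc k} {P = P} {Q} g maps inj with P zero in P0
... | false = count-image-≤ (g ∘ suc) (maps ∘ suc) inj′
  where
  inj′ : ∀ i j → P (suc i) ≡ true → P (suc j) ≡ true → g (suc i) ≡ g (suc j) → i ≡ j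
  inj′ i j i∈P j∈P gi≡gj = suc-injective (inj _ _ i∈P j∈P gi≡gj)
... | true  = subst (suc (count (P ∘ suc)) ≤_) (sym (count-remove Q (maps zero P0)))
                    (s≤s (count-image-≤ (g ∘ suc) maps′ inj′))
  where
  inj′ : ∀ i j → P (suc i) ≡ true → P (suc j) ≡ true → g (suc i) ≡ g (suc j) → i ≡ j
  inj′ i j i∈P j∈P gi≡gj = suc-injective (inj _ _ i∈P j∈P gi≡gj)
  maps′ : ∀ i → P (suc i) ≡ true → g (suc i) ∈ ∁ ｛ g zero ｝ ∩ Q
  maps′ i i∈P = ∈-∩ (∉⇒∈∁ (≢⇒∉｛｝ λ g≡ → 0≢1+n (inj zero (suc i) P0 i∈P (sym g≡)))) (maps (suc i) i∈P)

-- Sums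

<∸⇒+< : ∀ {a b c} → b < c ∸ a → a + b < c
<∸⇒+< {a} {b} {c} b<c∸a = subst (_≤ c) (cong suc (+-comm b a)) (m≤o∸n⇒m+n≤o (suc b) a≤c b<c∸a)
  where
  a≤c : a ≤ c
  a≤c = <⇒≤ (m∸n≢0⇒n<m λ c∸a≡0 → n≮0 (subst (b <_) c∸a≡0 b<c∸a))

sumN-cong : ∀ {k} (P : BSet k) {g h : Fin k → ℕ} → (∀ i → g i ≡ h i) → sumN P g ≡ sumN P h
sumN-cong {zero}  P g≗h = refl
sumN-cong {suc k} P g≗h =
  cong₂ (λ a b → (if P zero then a else 0) + b) (g≗h zero) (sumN-cong (P ∘ suc) (g≗h ∘ suc))

sumN-mono : ∀ {k} (P : BSet k) {g h : Fin k → ℕ} → (∀ i → i ∈ P → g i ≤ h i) → sumN P g ≤ sumN P h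
sumN-mono {zero}  P g≤h = z≤n
sumN-mono {suc k} P g≤h with P zero in P0
... | true  = +-mono-≤ (g≤h zero P0) (sumN-mono (P ∘ suc) (g≤h ∘ suc))
... | false = sumN-mono (P ∘ suc) (g≤h ∘ suc)

sumN-mono-< : ∀ {k} (P : BSet k) {g h : Fin k → ℕ} → (∀ i → i ∈ P → g i ≤ h i) →
  ∀ {j} → j ∈ P → g j < h j → sumN P g < sumN P h
sumN-mono-< {suc k} P g≤h {zero} j∈P gj<hj rewrite j∈P =
  +-mono-<-≤ gj<hj (sumN-mono (P ∘ suc) (g≤h ∘ suc))
sumN-mono-< {suc k} P g≤h {suc j} j∈P gj<hj with P zero in P0
... | true  = +-mono-≤-< (g≤h zero P0) (sumN-mono-< (P ∘ suc) (g≤h ∘ suc) j∈P gj<hj)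
... | false = sumN-mono-< (P ∘ suc) (g≤h ∘ suc) j∈P gj<hj

sumN-+ : ∀ {k} (P : BSet k) (g h : Fin k → ℕ) → sumN P (λ i → g i + h i) ≡ sumN P g + sumN P h
sumN-+ {zero}  P g h = refl
sumN-+ {suc k} P g h rewrite sumN-+ (P ∘ suc) (g ∘ suc) (h ∘ suc) with P zero
... | true  = interchange (g zero) (h zero) _ _
... | false = refl

sumN-<⇒∃ : ∀ {k} (P : BSet k) (g h : Fin k → ℕ) → sumN P g < sumN P h → ∃ λ i → i ∈ P × g i < h i
sumN-<⇒∃ P g h Σg<Σh with any? (λ i → (P i ≟ᵇ true) ×-dec (g i <? h i))
... | yes found = found
... | no  none  = contradiction (sumN-mono P h≤g) (<⇒≱ Σg<Σh)
  where
  h≤g : ∀ i → i ∈ P → h i ≤ g i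
  h≤g i i∈P = ≮⇒≥ λ gi<hi → none (i , i∈P , gi<hi)

sumN-≥⇒≡ : ∀ {k} (P : BSet k) {g h : Fin k → ℕ} → (∀ i → i ∈ P → g i ≤ h i) → sumN P h ≤ sumN P g →
  ∀ i → i ∈ P → g i ≡ h i
sumN-≥⇒≡ P g≤h Σh≤Σg i i∈P = ≤∧≮⇒≡ (g≤h i i∈P) λ gi<hi → <⇒≱ (sumN-mono-< P g≤h i∈P gi<hi) Σh≤Σg

sumN-≤-+∸ : ∀ {k} (P : BSet k) (F A : Fin k → ℕ) → sumN P F ≤ sumN P A + sumN P (λ i → F i ∸ A i)
sumN-≤-+∸ P F A =
  ≤-trans (sumN-mono P λ i _ → m≤n+m∸n (F i) (A i)) (≤-reflexive (sumN-+ P A (λ i → F i ∸ A i)))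

sumN-<-+∸ : ∀ {k} (P : BSet k) (F A : Fin k → ℕ) {j : Fin k} → j ∈ P → F j < A j →
  sumN P F < sumN P A + sumN P (λ i → F i ∸ A i)
sumN-<-+∸ P F A j∈P Fj<Aj =
  <-≤-trans (sumN-mono-< P (λ i _ → m≤n+m∸n (F i) (A i)) j∈P (<-≤-trans Fj<Aj (m≤m+n _ _)))
            (≤-reflexive (sumN-+ P A (λ i → F i ∸ A i)))

sumPairs≡sumN : ∀ {k} (P : BSet k) (g : Fin k → ℕ × ℕ) →
  sumPairs P g ≡ (sumN P (proj₁ ∘ g) , sumN P (proj₂ ∘ g))
sumPairs≡sumN {zero}  P g = refl
sumPairs≡sumN {suc k} P g rewrite sumPairs≡sumN (P ∘ suc) (g ∘ suc) with P zero
... | true  = refl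
... | false = refl

sumN-count-disjoint-≤ : ∀ {k l} (P : BSet k) (B : Fin k → BSet l) {U : BSet l} → (∀ y → y ∈ P → B y ⊆ U) →
  (∀ y y′ z → y ∈ P → y′ ∈ P → z ∈ B y → z ∈ B y′ → y ≡ y′) → sumN P (count ∘ B) ≤ count U
sumN-count-disjoint-≤ {zero}  P B         B⊆U disjoint = z≤n
sumN-count-disjoint-≤ {suc k} P B {U} B⊆U disjoint with P zero in P0
... | false = sumN-count-disjoint-≤ (P ∘ suc) (B ∘ suc) (B⊆U ∘ suc) disjoint′
  where
  disjoint′ : ∀ y y′ z → P (suc y) ≡ true → P (suc y′) ≡ true → z ∈ B (suc y) → z ∈ B (suc y′) → y ≡ y′
  disjoint′ y y′ z y∈P y′∈P z∈B z∈B′ = suc-injective (disjoint (suc y) (suc y′) z y∈P y′∈P z∈B z∈B′)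
... | true  = begin
  count (B zero) + sumN (P ∘ suc) (count ∘ B ∘ suc) ≤⟨ +-monoʳ-≤ (count (B zero)) rest ⟩
  count (B zero) + count (∁ (B zero) ∩ U)           ≡⟨ count-∪ (B zero) (∁ (B zero) ∩ U) B₀∩rest≡∅ ⟨
  count (B zero ∪ ∁ (B zero) ∩ U)                   ≤⟨ count-mono B₀∪rest⊆U ⟩
  count U                                           ∎
  where
  open ≤-Reasoning
  disjoint′ : ∀ y y′ z → P (suc y) ≡ true → P (suc y′) ≡ true → z ∈ B (suc y) → z ∈ B (suc y′) → y ≡ y′
  disjoint′ y y′ z y∈P y′∈P z∈B z∈B′ = suc-injective (disjoint (suc y) (suc y′) z y∈P y′∈P z∈B z∈B′)
  rest⊆ : ∀ y → P (suc y) ≡ true → B (suc y) ⊆ ∁ (B zero) ∩ U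
  rest⊆ y y∈P z z∈B = ∈-∩ (∉⇒∈∁ (¬∈⇒∉ λ z∈B₀ → 0≢1+n (disjoint zero (suc y) z P0 y∈P z∈B₀ z∈B)))
                          (B⊆U (suc y) y∈P z z∈B)
  rest : sumN (P ∘ suc) (count ∘ B ∘ suc) ≤ count (∁ (B zero) ∩ U)
  rest = sumN-count-disjoint-≤ (P ∘ suc) (B ∘ suc) rest⊆ disjoint′
  B₀∩rest≡∅ : Disjoint (B zero) (∁ (B zero) ∩ U)
  B₀∩rest≡∅ z z∈B₀ z∈rest = ∈∉⇒⊥ z∈B₀ (∈∁⇒∉ (proj₁ (∈-∩⁻ z∈rest)))
  B₀∪rest⊆U : B zero ∪ ∁ (B zero) ∩ U ⊆ U
  B₀∪rest⊆U z z∈ with B zero z in z∈B₀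
  ... | true  = B⊆U zero P0 z z∈B₀
  ... | false = z∈

-- Reversing every arc swaps out- and in-degrees, so each in-degree statement below is the
-- out-degree statement for the reversed configuration.
reverse : Digraph → Digraph
reverse D = record { n = n D ; arc = λ a b → arc D b a ; loopless = loopless D }

reverseCover : ∀ {D} → Cover D → Cover (reverse D)
reverseCover C = record
  { m         = m C
  ; harc      = λ x y → harc C y x
  ; hloopless = hloopless C
  ; p         = p C
  ; indep     = λ x y px≡py → indep C y x (sym px≡py)
  ; noArc     = λ x y yx → noArc C y x yx
  ; matchOut  = λ x y y′ yx y′x py≡py′ → matchIn C y y′ x yx y′x py≡py′
  ; matchIn   = λ x x′ y yx yx′ px≡px′ → matchOut C y x x′ yx yx′ px≡px′
  }

module _ {D : Digraph} (C : Cover D) where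

  ∈X⇒ : ∀ {w x} → inX C w x ≡ true → p C x ≡ w
  ∈X⇒ = ∈｛｝⇒≡

  ⇒∈X : ∀ {w x} → p C x ≡ w → inX C w x ≡ true
  ⇒∈X refl = x∈｛x｝

  TransversalOn : BSet (n D) → BSet (m C) → Set
  TransversalOn Q T = ∀ w → countIn C T w ≡ ind (Q w)

  partial⇒injective : ∀ {T z z′} → PartialTransversal C T → z ∈ T → z′ ∈ T → p C z ≡ p C z′ → z ≡ z′
  partial⇒injective {T} {z} {z′} pt z∈T z′∈T pz≡pz′ =
    count≤1⇒≡ {P = T ∩ inX C (p C z′)} (pt (p C z′)) (∈-∩ z′∈T (⇒∈X refl)) (∈-∩ z∈T (⇒∈X pz≡pz′))

  module _ {Q : BSet (n D)} {T : BSet (m C)} (tr : TransversalOn Q T) where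

    TransversalOn⇒partial : PartialTransversal C T
    TransversalOn⇒partial w = subst (_≤ 1) (sym (tr w)) (ind≤1 (Q w))

    TransversalOn⇒class∈ : ∀ {z} → z ∈ T → p C z ∈ Q
    TransversalOn⇒class∈ {z} z∈T =
      0<ind⇒ (subst (0 <_) (tr (p C z)) (0<count {P = T ∩ inX C (p C z)} (∈-∩ z∈T (⇒∈X refl))))

  TransversalOn-∅ : TransversalOn ∅ ∅
  TransversalOn-∅ _ = count-∅ {m C}

  TransversalOn-｛｝ : ∀ {x u} → p C x ≡ u → TransversalOn ｛ u ｝ ｛ x ｝
  TransversalOn-｛｝ {x} refl w = trans (count-｛｝∩ x (inX C w)) (cong ind (｛｝-sym (p C x) w))

  TransversalOn-cong : ∀ {Q Q′ T} → (∀ w → Q w ≡ Q′ w) → TransversalOn Q T → TransversalOn Q′ T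
  TransversalOn-cong Q≗Q′ tr w = trans (tr w) (cong ind (Q≗Q′ w))

  TransversalOn-∪ : ∀ {Q Q′ T T′} → Disjoint Q Q′ → TransversalOn Q T → TransversalOn Q′ T′ →
    TransversalOn (Q ∪ Q′) (T ∪ T′)
  TransversalOn-∪ {Q} {Q′} {T} {T′} Q∩Q′≡∅ tr tr′ w = begin
    count ((T ∪ T′) ∩ inX C w)                 ≡⟨ count-∪∩ T T′ (inX C w) T∩T′≡∅ ⟩
    count (T ∩ inX C w) + count (T′ ∩ inX C w) ≡⟨ cong₂ _+_ (tr w) (tr′ w) ⟩
    ind (Q w) + ind (Q′ w)                     ≡⟨ ind-∨ (Q w) (Q′ w) w∉Q∩Q′ ⟨
    ind ((Q ∪ Q′) w)                           ∎
    where
    open ≡-Reasoning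
    T∩T′≡∅ : Disjoint T T′
    T∩T′≡∅ z z∈T z∈T′ = Q∩Q′≡∅ (p C z) (TransversalOn⇒class∈ tr z∈T) (TransversalOn⇒class∈ tr′ z∈T′)
    w∉Q∩Q′ : Q w ∧ Q′ w ≡ true → ⊥
    w∉Q∩Q′ w∈Q∩Q′ = Q∩Q′≡∅ w (proj₁ (∈-∩⁻ w∈Q∩Q′)) (proj₂ (∈-∩⁻ w∈Q∩Q′))

  ∪｛｝-transversal : ∀ {u T x} → TransversalOn (∁ ｛ u ｝) T → p C x ≡ u → Transversal C (T ∪ ｛ x ｝)
  ∪｛｝-transversal {u} tr px≡u =
    TransversalOn-cong (λ w → ∨-inverseˡ ⌊ w ≟ u ⌋)
      (TransversalOn-∪ (∁｛｝-disjoint u) tr (TransversalOn-｛｝ px≡u))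

  module _ {u : Fin (n D)} {T : BSet (m C)} where

    TransversalOn-∁｛｝⇒DomAllBut : TransversalOn (∁ ｛ u ｝) T → DomAllBut C T u
    TransversalOn-∁｛｝⇒DomAllBut tr v = avoids-u , meets-others
      where
      avoids-u : 1 ≤ countIn C T v → v ≢ u
      avoids-u 0<count refl = n≮0 (subst (0 <_) (trans (tr u) (cong (ind ∘ not) x∈｛x｝)) 0<count)
      meets-others : v ≢ u → 1 ≤ countIn C T v
      meets-others v≢u = subst (1 ≤_) (sym (trans (tr v) (cong (ind ∘ not) (≢⇒∉｛｝ v≢u)))) ≤-refl

    partial×DomAllBut⇒TransversalOn : PartialTransversal C T → DomAllBut C T u → TransversalOn (∁ ｛ u ｝) T
    partial×DomAllBut⇒TransversalOn pt dom v with v ≟ u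
    ... | yes refl = n≤0⇒n≡0 (≮⇒≥ λ 0<count → proj₁ (dom u) 0<count refl)
    ... | no  v≢u  = ≤-antisym (pt v) (proj₂ (dom v) v≢u)

  -- A vertex of T has at most one in-neighbour in X_w (arcs between two classes form a matching),
  -- and distinct vertices of T lie in distinct classes.
  sumN-arcsInto-≤ : ∀ {E T} → TransversalOn E T → ∀ w →
    sumN (inX C w) (λ y → count (T ∩ harc C y)) ≤ count (E ∩ arc D w)
  sumN-arcsInto-≤ {E} {T} tr w =
    ≤-trans (sumN-count-disjoint-≤ (inX C w) (λ y → T ∩ harc C y) {U = T ∩ (E ∩ arc D w) ∘ p C}
                                   arcsInto⊆ sharedHead)
            (count-image-≤ (p C) (λ z z∈U → proj₂ (∈-∩⁻ {T z} z∈U)) λ z z′ z∈U z′∈U →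
               partial⇒injective (TransversalOn⇒partial tr) (proj₁ (∈-∩⁻ z∈U)) (proj₁ (∈-∩⁻ z′∈U)))
    where
    arcsInto⊆ : ∀ y → y ∈ inX C w → T ∩ harc C y ⊆ T ∩ (E ∩ arc D w) ∘ p C
    arcsInto⊆ y y∈X z z∈ with ∈-∩⁻ z∈
    ... | z∈T , yz = ∈-∩ z∈T (∈-∩ (TransversalOn⇒class∈ tr z∈T)
                                 (subst (λ a → arc D a (p C z) ≡ true) (∈X⇒ y∈X) (noArc C y z yz)))
    sharedHead : ∀ y y′ z → y ∈ inX C w → y′ ∈ inX C w → z ∈ T ∩ harc C y → z ∈ T ∩ harc C y′ → y ≡ y′
    sharedHead y y′ z y∈X y′∈X z∈ z∈′ =
      matchIn C y y′ z (proj₂ (∈-∩⁻ z∈)) (proj₂ (∈-∩⁻ z∈′)) (trans (∈X⇒ y∈X) (sym (∈X⇒ y′∈X)))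

-- Strict degeneracy

module _ {D : Digraph} (C : Cover D) (f : Fin (m C) → ℕ × ℕ) where

  Light : BSet (m C) → Fin (m C) → Set
  Light T y = proj₁ (degIn C T y) < proj₁ (f y) ⊎ proj₂ (degIn C T y) < proj₂ (f y)

  Light-∅ : ∀ {y} → f y ≢ (0 , 0) → Light ∅ y
  Light-∅ {y} fy≢0 with f y
  ... | suc _ , _     = inj₁ (subst (_< suc _) (sym (count-∅ {m C})) z<s)
  ... | zero  , suc _ = inj₂ (subst (_< suc _) (sym (count-∅ {m C})) z<s)
  ... | zero  , zero  = contradiction refl fy≢0

  degIn-addV : ∀ T x → degIn C (addV C T x) x ≡ degIn C T x
  degIn-addV T x =
    cong₂ _,_ (count-∪｛｝∩ T (harc C x) (hloopless C x)) (count-∪｛｝∩ T (λ z → harc C z x) (hloopless C x))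

  SD-∅ : StrictlyDegenerate C f ∅
  SD-∅ S R S⊆∅ _ (x , x∈S) = ⊥-elim (∈∉⇒⊥ (S⊆∅ x x∈S) refl)

  SD-⊆ : ∀ {T T′} → StrictlyDegenerate C f T → T′ ⊆ T → StrictlyDegenerate C f T′
  SD-⊆ sd T′⊆T S R S⊆T′ = sd S R λ x x∈S → T′⊆T x (S⊆T′ x x∈S)

  SD-addV : ∀ {T y} → StrictlyDegenerate C f T → Light T y → StrictlyDegenerate C f (addV C T y)
  SD-addV {T} {y} sd light S R S⊆T+y R⊆ S≢∅ with S y in y∈S
  ... | true  = y , y∈S , Sum.map (≤-<-trans (count-mono out⊆)) (≤-<-trans (count-mono in⊆)) light
    where
    out⊆ : R y ⊆ T ∩ harc C y
    out⊆ z Ryz with R⊆ y z Ryz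
    ... | yz , _ , z∈S = ∈-∩ (∈∪｛｝⇒∈ T (S⊆T+y z z∈S) λ { refl → ∈∉⇒⊥ yz (hloopless C y) }) yz
    in⊆ : (λ z → R z y) ⊆ (λ z → T z ∧ harc C z y)
    in⊆ z Rzy with R⊆ z y Rzy
    ... | zy , z∈S , _ = ∈-∩ (∈∪｛｝⇒∈ T (S⊆T+y z z∈S) λ { refl → ∈∉⇒⊥ zy (hloopless C y) }) zy
  ... | false = sd S R (λ z z∈S → ∈∪｛｝⇒∈ T (S⊆T+y z z∈S) λ { refl → ∈∉⇒⊥ z∈S y∈S }) R⊆ S≢∅

-- The truncated subtraction discards those y ∈ X_w that T₀ already saturates; this is what
-- makes the pointwise bound f⁺(x) ≥ a_H(x, x_v) of part (b) come out.
OutSlack : (D : Digraph) (C : Cover D) → (Fin (m C) → ℕ) → BSet (m C) → BSet (n D) → Fin (n D) → Set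
OutSlack D C F T₀ Q w = count (Q ∩ arc D w) < sumN (inX C w) (λ y → F y ∸ count (T₀ ∩ harc C y))

module _ {D : Digraph} (C : Cover D) (F : Fin (m C) → ℕ) where

  OutSlack⇒∃ : ∀ {E Q T₀ T₁ w} → TransversalOn C E T₁ → E ⊆ Q → OutSlack D C F T₀ Q w →
    ∃ λ y → p C y ≡ w × count ((T₀ ∪ T₁) ∩ harc C y) < F y
  OutSlack⇒∃ {E} {Q} {T₀} {T₁} {w} tr₁ E⊆Q slack
    with sumN-<⇒∃ (inX C w) (out T₁) (λ y → F y ∸ out T₀ y) Σout<Σcap
    where
    open ≤-Reasoning
    out : BSet (m C) → Fin (m C) → ℕ
    out T y = count (T ∩ harc C y)
    Σout<Σcap : sumN (inX C w) (out T₁) < sumN (inX C w) (λ y → F y ∸ out T₀ y)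
    Σout<Σcap = begin-strict
      sumN (inX C w) (out T₁)                ≤⟨ sumN-arcsInto-≤ C tr₁ w ⟩
      count (E ∩ arc D w)                    ≤⟨ count-mono E∩⊆Q∩ ⟩
      count (Q ∩ arc D w)                    <⟨ slack ⟩
      sumN (inX C w) (λ y → F y ∸ out T₀ y)  ∎
      where
      E∩⊆Q∩ : E ∩ arc D w ⊆ Q ∩ arc D w
      E∩⊆Q∩ u u∈ = ∈-∩ (E⊆Q u (proj₁ (∈-∩⁻ u∈))) (proj₂ (∈-∩⁻ u∈))
  ... | y , y∈X , out₁<cap = y , ∈X⇒ C y∈X , (begin-strict
    count ((T₀ ∪ T₁) ∩ harc C y)                   ≡⟨ count-cong (λ z → ∧-distribʳ-∨ (harc C y z) (T₀ z) _) ⟩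
    count (T₀ ∩ harc C y ∪ T₁ ∩ harc C y)          ≤⟨ count-∪-≤ (T₀ ∩ harc C y) (T₁ ∩ harc C y) ⟩
    count (T₀ ∩ harc C y) + count (T₁ ∩ harc C y)  <⟨ <∸⇒+< out₁<cap ⟩
    F y                                            ∎)
    where open ≤-Reasoning

  OutSlack-∅ : ∀ {Q w} → count (Q ∩ arc D w) < sumN (inX C w) F → OutSlack D C F ∅ Q w
  OutSlack-∅ {Q} {w} =
    subst (count (Q ∩ arc D w) <_) (sumN-cong (inX C w) λ y → cong (F y ∸_) (sym (count-∅ {m C})))

  arc⇒OutSlack : ∀ {E T₀ Q a b} → TransversalOn C E T₀ → Disjoint Q E → b ∉ Q → b ∉ E → arc D a b ≡ true →
    count (arc D a) ≤ sumN (inX C a) F → OutSlack D C F T₀ Q a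
  arc⇒OutSlack {E} {T₀} {Q} {a} {b} tr₀ Q∩E≡∅ b∉Q b∉E ab feasible =
    +-cancelˡ-< (count (E ∩ arc D a)) _ _ (begin-strict
      count (E ∩ arc D a) + count (Q ∩ arc D a) ≡⟨ count-∪∩ E Q (arc D a) (λ u u∈E u∈Q → Q∩E≡∅ u u∈Q u∈E) ⟨
      count ((E ∪ Q) ∩ arc D a)                 <⟨ count-< (λ u u∈ → proj₂ (∈-∩⁻ {E u ∨ Q u} u∈)) ab b∉ ⟩
      count (arc D a)                           ≤⟨ feasible ⟩
      sumN (inX C a) F                          ≤⟨ sumN-≤-+∸ (inX C a) F out₀ ⟩
      sumN (inX C a) out₀ + S                   ≤⟨ +-monoˡ-≤ S (sumN-arcsInto-≤ C tr₀ a) ⟩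
      count (E ∩ arc D a) + S                   ∎)
    where
    open ≤-Reasoning
    out₀ : Fin (m C) → ℕ
    out₀ y = count (T₀ ∩ harc C y)
    S : ℕ
    S = sumN (inX C a) (λ y → F y ∸ out₀ y)
    b∉ : (E b ∨ Q b) ∧ arc D a b ≡ false
    b∉ = cong₂ (λ x y → (x ∨ y) ∧ arc D a b) b∉E b∉Q

  noOutSlack⇒arcsTo : ∀ {u v xv} → p C xv ≡ v → sumN (inX C u) F ≡ count (arc D u) →
    ¬ OutSlack D C F ｛ xv ｝ (∁ ｛ v ｝) u →
    (∀ x → p C x ≡ u → ind (harc C x xv) ≤ F x) × sumN (inX C u) (λ x → ind (harc C x xv)) ≡ ind (arc D u v)
  noOutSlack⇒arcsTo {u} {v} {xv} pxv≡v ΣF≡d⁺ noSlack =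
    A≤F , ≤-antisym ΣA≤a (+-cancelʳ-≤ c a (sumN (inX C u) A) a+c≤ΣA+c)
    where
    open ≤-Reasoning
    A : Fin (m C) → ℕ
    A x = ind (harc C x xv)
    a c : ℕ
    a = ind (arc D u v)
    c = count (∁ ｛ v ｝ ∩ arc D u)
    ΣF≡a+c : sumN (inX C u) F ≡ a + c
    ΣF≡a+c = trans ΣF≡d⁺ (count-split (arc D u) v)
    ΣA≤a : sumN (inX C u) A ≤ a
    ΣA≤a = subst₂ _≤_ (sumN-cong (inX C u) λ x → count-｛｝∩ xv (harc C x)) (count-｛｝∩ v (arc D u))
             (sumN-arcsInto-≤ C (TransversalOn-｛｝ C pxv≡v) u)
    ΣF∸A≤c : sumN (inX C u) (λ x → F x ∸ A x) ≤ c
    ΣF∸A≤c = ≮⇒≥ λ c<ΣF∸A →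
      noSlack (subst (c <_) (sumN-cong (inX C u) λ x → cong (F x ∸_) (sym (count-｛｝∩ xv (harc C x)))) c<ΣF∸A)
    A≤F : ∀ x → p C x ≡ u → A x ≤ F x
    A≤F x px≡u with A x ≤? F x
    ... | yes Ax≤Fx = Ax≤Fx
    ... | no  Ax≰Fx = contradiction (begin-strict
      a + c                                                ≡⟨ ΣF≡a+c ⟨
      sumN (inX C u) F                                     <⟨ sumN-<-+∸ (inX C u) F A (⇒∈X C px≡u) (≰⇒> Ax≰Fx) ⟩
      sumN (inX C u) A + sumN (inX C u) (λ x → F x ∸ A x)  ≤⟨ +-mono-≤ ΣA≤a ΣF∸A≤c ⟩
      a + c                                                ∎) (<-irrefl refl)
    a+c≤ΣA+c : a + c ≤ sumN (inX C u) A + c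
    a+c≤ΣA+c = begin
      a + c                                                ≡⟨ ΣF≡a+c ⟨
      sumN (inX C u) F                                     ≤⟨ sumN-≤-+∸ (inX C u) F A ⟩
      sumN (inX C u) A + sumN (inX C u) (λ x → F x ∸ A x)  ≤⟨ +-monoʳ-≤ (sumN (inX C u) A) ΣF∸A≤c ⟩
      sumN (inX C u) A + c                                 ∎

  saturated⇒outdeg≡ : ∀ {E T u} → TransversalOn C E T → sumN (inX C u) F ≡ count (arc D u) →
    (∀ x → p C x ≡ u → F x ≤ count (T ∩ harc C x)) → ∀ x → p C x ≡ u → F x ≡ count (T ∩ harc C x)
  saturated⇒outdeg≡ {E} {T} {u} tr ΣF≡d⁺ saturated x px≡u =
    sumN-≥⇒≡ (inX C u) (λ y y∈X → saturated y (∈X⇒ C y∈X)) Σout≤ΣF x (⇒∈X C px≡u)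
    where
    open ≤-Reasoning
    Σout≤ΣF : sumN (inX C u) (λ y → count (T ∩ harc C y)) ≤ sumN (inX C u) F
    Σout≤ΣF = begin
      sumN (inX C u) (λ y → count (T ∩ harc C y)) ≤⟨ sumN-arcsInto-≤ C tr u ⟩
      count (E ∩ arc D u)                         ≤⟨ count-mono (λ w w∈ → proj₂ (∈-∩⁻ {E w} w∈)) ⟩
      count (arc D u)                             ≡⟨ ΣF≡d⁺ ⟨
      sumN (inX C u) F                            ∎

-- Greedy colouring

Star⇒crossing : ∀ {A : Set} {R : A → A → Set} (Q : A → Bool) {a b} → Star R a b → Q a ≡ true → Q b ≡ false →
  ∃ λ a′ → ∃ λ b′ → Q a′ ≡ true × Q b′ ≡ false × R a′ b′
Star⇒crossing Q ε a∈Q a∉Q = ⊥-elim (∈∉⇒⊥ a∈Q a∉Q)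
Star⇒crossing Q (_◅_ {j = c} Rac path) a∈Q b∉Q with Q c in c∈Q
... | false = _ , c , a∈Q , c∈Q , Rac
... | true  = Star⇒crossing Q path c∈Q b∉Q

module _ {D : Digraph} (C : Cover D) (f : Fin (m C) → ℕ × ℕ) where

  Slack : BSet (m C) → BSet (n D) → Fin (n D) → Set
  Slack T₀ Q w = OutSlack D C (proj₁ ∘ f) T₀ Q w ⊎ OutSlack (reverse D) (reverseCover C) (proj₂ ∘ f) T₀ Q w

  Slack? : ∀ T₀ Q w → Dec (Slack T₀ Q w)
  Slack? T₀ Q w = (_ <? _) ⊎-dec (_ <? _)

  Slack-cong : ∀ {T₀ Q Q′ w} → (∀ u → Q u ≡ Q′ u) → Slack T₀ Q w → Slack T₀ Q′ w
  Slack-cong {w = w} Q≗Q′ = Sum.map (subst (_< _) (count-cong λ u → cong (_∧ arc D w u) (Q≗Q′ u)))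
                                    (subst (_< _) (count-cong λ u → cong (_∧ arc D u w) (Q≗Q′ u)))

  Slack⇒Light : ∀ {E Q T₀ T₁ w} → TransversalOn C E T₁ → E ⊆ Q → Slack T₀ Q w →
    ∃ λ y → p C y ≡ w × Light C f (T₀ ∪ T₁) y
  Slack⇒Light tr₁ E⊆Q (inj₁ slack)
    with y , py≡w , light ← OutSlack⇒∃ C (proj₁ ∘ f) tr₁ E⊆Q slack = y , py≡w , inj₁ light
  Slack⇒Light tr₁ E⊆Q (inj₂ slack)
    with y , py≡w , light ← OutSlack⇒∃ (reverseCover C) (proj₂ ∘ f) tr₁ E⊆Q slack = y , py≡w , inj₂ light

  feasible : DegreeFeasible C f → ∀ v →
    (count (arc D v) ≤ sumN (inX C v) (proj₁ ∘ f)) × (count (λ w → arc D w v) ≤ sumN (inX C v) (proj₂ ∘ f))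
  feasible feas v = subst (deg D v ≤²_) (sumPairs≡sumN (inX C v) f) (feas v)

  arc⇒Slack : DegreeFeasible C f → ∀ {E T₀ Q a b} → TransversalOn C E T₀ → Disjoint Q E → b ∉ Q → b ∉ E →
    Adj D a b → Slack T₀ Q a
  arc⇒Slack feas {a = a} tr₀ Q∩E≡∅ b∉Q b∉E (inj₁ ab) =
    inj₁ (arc⇒OutSlack C (proj₁ ∘ f) tr₀ Q∩E≡∅ b∉Q b∉E ab (proj₁ (feasible feas a)))
  arc⇒Slack feas {a = a} tr₀ Q∩E≡∅ b∉Q b∉E (inj₂ ba) =
    inj₂ (arc⇒OutSlack (reverseCover C) (proj₂ ∘ f) tr₀ Q∩E≡∅ b∉Q b∉E ba (proj₂ (feasible feas a)))

  path⇒Slack : DegreeFeasible C f → ∀ {E T₀ Q} → TransversalOn C E T₀ → Disjoint Q E →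
    {R : Fin (n D) → Fin (n D) → Set} → (∀ {a b} → R a b → Adj D a b × b ∉ E) →
    ∀ {a b} → Star R a b → a ∈ Q → b ∉ Q → ∃ λ w → w ∈ Q × Slack T₀ Q w
  path⇒Slack feas tr₀ Q∩E≡∅ R⇒Adj path a∈Q b∉Q
    with a′ , b′ , a′∈Q , b′∉Q , Ra′b′ ← Star⇒crossing _ path a∈Q b∉Q =
    a′ , a′∈Q , arc⇒Slack feas tr₀ Q∩E≡∅ b′∉Q (proj₂ (R⇒Adj Ra′b′)) (proj₁ (R⇒Adj Ra′b′))

  Peelable : BSet (m C) → BSet (n D) → Set
  Peelable T₀ Q = ∀ Q′ → Q′ ⊆ Q → (∃ λ w → w ∈ Q′) → ∃ λ w → w ∈ Q′ × Slack T₀ Q′ w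

  extend : ∀ {T₀ Q} → StrictlyDegenerate C f T₀ → Peelable T₀ Q →
    ∃ λ T₁ → TransversalOn C Q T₁ × StrictlyDegenerate C f (T₀ ∪ T₁)
  extend sd peel = go _ refl sd peel
    where
    go : ∀ {T₀ Q} k → count Q ≡ k → StrictlyDegenerate C f T₀ → Peelable T₀ Q →
      ∃ λ T₁ → TransversalOn C Q T₁ × StrictlyDegenerate C f (T₀ ∪ T₁)
    go {T₀} zero |Q|≡0 sd _ =
      ∅ , (λ w → trans (count-∅ {m C}) (cong ind (sym (count≡0⇒∉ |Q|≡0 w)))) ,
      SD-⊆ C f sd λ z z∈ → trans (sym (∨-identityʳ (T₀ z))) z∈
    go {T₀} {Q} (suc k) |Q|≡1+k sd peel
      with w , w∈Q , slack ← peel Q (λ _ u∈Q → u∈Q) (count≢0⇒∃ Q (subst (_≢ 0) (sym |Q|≡1+k) λ ())) =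
      let Q∖w⊆Q = λ u (u∈ : u ∈ ∁ ｛ w ｝ ∩ Q) → proj₂ (∈-∩⁻ {not ⌊ u ≟ w ⌋} u∈)
          |Q∖w|≡k = cong pred (trans (sym (count-remove Q w∈Q)) |Q|≡1+k)
          (T₁ , tr₁ , sd₁) = go k |Q∖w|≡k sd λ Q′ Q′⊆Q∖w → peel Q′ λ u u∈Q′ → Q∖w⊆Q u (Q′⊆Q∖w u u∈Q′)
          (y , py≡w , light) = Slack⇒Light tr₁ Q∖w⊆Q slack
      in T₁ ∪ ｛ y ｝ ,
         TransversalOn-cong C (∁｛｝∩-∪｛｝ Q w∈Q)
           (TransversalOn-∪ C (λ u u∈Q∖w → ∁｛｝-disjoint w u (proj₁ (∈-∩⁻ u∈Q∖w))) tr₁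
                              (TransversalOn-｛｝ C py≡w)) ,
         SD-⊆ C f (SD-addV C f sd₁ light) λ z z∈ → trans (∨-assoc (T₀ z) (T₁ z) _) z∈

  -- Only ¬¬-connectivity is available for D − v; it suffices because slack is decidable.
  peelable : DegreeFeasible C f → ∀ {E T₀ Q} → TransversalOn C E T₀ → Disjoint Q E →
    {R : Fin (n D) → Fin (n D) → Set} → (∀ {a b} → R a b → Adj D a b × b ∉ E) →
    (∀ a b → a ∈ Q → b ∈ Q → ¬ ¬ Star R a b) →
    ((∃ λ w → w ∈ Q) → ∃ λ w → w ∈ Q × Slack T₀ Q w) → Peelable T₀ Q
  peelable feas {E} {T₀} {Q} tr₀ Q∩E≡∅ R⇒Adj connected slackQ Q′ Q′⊆Q (a , a∈Q′)
    with any? (λ b → (Q b ≟ᵇ true) ×-dec (Q′ b ≟ᵇ false))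
  ... | no  Q⊆Q′ =
    let (w , w∈Q , slack) = slackQ (a , Q′⊆Q a a∈Q′) in w , trans (sym (Q≗Q′ w)) w∈Q , Slack-cong Q≗Q′ slack
    where
    Q≗Q′ : ∀ u → Q u ≡ Q′ u
    Q≗Q′ u with Q′ u in u∈Q′
    ... | true  = Q′⊆Q u u∈Q′
    ... | false = ¬∈⇒∉ λ u∈Q → Q⊆Q′ (u , u∈Q , u∈Q′)
  ... | yes (b , b∈Q , b∉Q′) with any? (λ w → (Q′ w ≟ᵇ true) ×-dec Slack? T₀ Q′ w)
  ...   | yes found = found
  ...   | no  none  = ⊥-elim (connected a b (Q′⊆Q a a∈Q′) b∈Q λ path →
                        none (path⇒Slack feas tr₀ (λ u u∈Q′ → Q∩E≡∅ u (Q′⊆Q u u∈Q′)) R⇒Adj path a∈Q′ b∉Q′))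

-- Uncolorable configurations

module UncolorableConfiguration {D : Digraph} {C : Cover D} {f : Fin (m C) → ℕ × ℕ}
  (conn : Connected D) (feas : DegreeFeasible C f) (uncol : Uncolorable C f) where

  colour : ∀ Q → ((∃ λ w → w ∈ Q) → ∃ λ w → w ∈ Q × Slack C f ∅ Q w) →
    ∃ λ T → TransversalOn C Q T × StrictlyDegenerate C f T
  colour Q slackQ = extend C f (SD-∅ C f)
    (peelable C f feas (TransversalOn-∅ C) (λ _ _ ()) (λ ab → ab , refl) (λ a b _ _ ¬path → ¬path (conn a b))
              slackQ)

  Σf≡deg : ∀ u →
    (sumN (inX C u) (proj₁ ∘ f) ≡ count (arc D u)) × (sumN (inX C u) (proj₂ ∘ f) ≡ count (λ w → arc D w u))
  Σf≡deg u = sym (≤∧≮⇒≡ d⁺≤Σf⁺ (noSlack ∘ inj₁ ∘ OutSlack-∅ C (proj₁ ∘ f))) ,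
             sym (≤∧≮⇒≡ d⁻≤Σf⁻ (noSlack ∘ inj₂ ∘ OutSlack-∅ (reverseCover C) (proj₂ ∘ f)))
    where
    d⁺≤Σf⁺ : count (arc D u) ≤ sumN (inX C u) (proj₁ ∘ f)
    d⁺≤Σf⁺ = proj₁ (feasible C f feas u)
    d⁻≤Σf⁻ : count (λ w → arc D w u) ≤ sumN (inX C u) (proj₂ ∘ f)
    d⁻≤Σf⁻ = proj₂ (feasible C f feas u)
    noSlack : ¬ Slack C f ∅ full u
    noSlack slack = uncol (colour full λ _ → u , refl , slack)

  fX≡deg : ∀ u → fX C f u ≡ deg D u
  fX≡deg u = trans (sumPairs≡sumN (inX C u) f) (cong₂ _,_ (proj₁ (Σf≡deg u)) (proj₂ (Σf≡deg u)))

  module _ {v xv} (nonsep : ¬ Separating D v) (pxv≡v : p C xv ≡ v) (fxv≢0 : f xv ≢ (0 , 0)) where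

    noSlack : ∀ {u} → u ≢ v → ¬ Slack C f ｛ xv ｝ (∁ ｛ v ｝) u
    noSlack {u} u≢v slack =
      let (T₁ , tr₁ , sd) = extend C f (SD-addV C f (SD-∅ C f) (Light-∅ C f fxv≢0)) peel
      in uncol (T₁ ∪ ｛ xv ｝ , ∪｛｝-transversal C tr₁ pxv≡v , SD-⊆ C f sd λ z z∈ → trans (∨-comm _ (T₁ z)) z∈)
      where
      peel : Peelable C f ｛ xv ｝ (∁ ｛ v ｝)
      peel = peelable C f feas (TransversalOn-｛｝ C pxv≡v) (∁｛｝-disjoint v) {R = AdjWithout D v}
               (λ (ab , _ , b≢v) → ab , ≢⇒∉｛｝ b≢v)
               (λ a b a∈∁v b∈∁v ¬path → nonsep (a , b , ∈∁｛｝⇒≢ a∈∁v , ∈∁｛｝⇒≢ b∈∁v , ¬path))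
               λ _ → u , ∉⇒∈∁ (≢⇒∉｛｝ u≢v) , slack

    arcsTo : ∀ u → u ≢ v →
      ((∀ x → p C x ≡ u → ind (harc C x xv) ≤ proj₁ (f x))
        × sumN (inX C u) (λ x → ind (harc C x xv)) ≡ ind (arc D u v))
      ×
      ((∀ x → p C x ≡ u → ind (harc C xv x) ≤ proj₂ (f x))
        × sumN (inX C u) (λ x → ind (harc C xv x)) ≡ ind (arc D v u))
    arcsTo u u≢v =
      noOutSlack⇒arcsTo C (proj₁ ∘ f) pxv≡v (proj₁ (Σf≡deg u)) (noSlack u≢v ∘ inj₁) ,
      noOutSlack⇒arcsTo (reverseCover C) (proj₂ ∘ f) pxv≡v (proj₂ (Σf≡deg u)) (noSlack u≢v ∘ inj₂)

  partialColouring : ∀ u → ∃ λ T → TransversalOn C (∁ ｛ u ｝) T × StrictlyDegenerate C f T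
  partialColouring u = colour (∁ ｛ u ｝) λ (a , a∈∁u) →
    path⇒Slack C f feas (TransversalOn-∅ C) (λ _ _ ()) (λ ab → ab , refl) (conn a u) a∈∁u (cong not x∈｛x｝)

  f≡degIn : ∀ {u T} → TransversalOn C (∁ ｛ u ｝) T → StrictlyDegenerate C f T →
    ∀ x → p C x ≡ u → f x ≡ degIn C (addV C T x) x
  f≡degIn {u} {T} tr sd x px≡u = begin
    (proj₁ (f x) , proj₂ (f x))                                  ≡⟨ cong₂ _,_ out≡ in≡ ⟩
    (count (T ∩ harc C x) , count (λ z → T z ∧ harc C z x))      ≡⟨ degIn-addV C f T x ⟨
    degIn C (addV C T x) x                                       ∎
    where
    open ≡-Reasoning
    notLight : ∀ y → p C y ≡ u → ¬ Light C f T y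
    notLight y py≡u light = uncol (addV C T y , ∪｛｝-transversal C tr py≡u , SD-addV C f sd light)
    out≡ : proj₁ (f x) ≡ count (T ∩ harc C x)
    out≡ = saturated⇒outdeg≡ C (proj₁ ∘ f) tr (proj₁ (Σf≡deg u))
             (λ y py≡u → ≮⇒≥ (notLight y py≡u ∘ inj₁)) x px≡u
    in≡ : proj₂ (f x) ≡ count (λ z → T z ∧ harc C z x)
    in≡ = saturated⇒outdeg≡ (reverseCover C) (proj₂ ∘ f) tr (proj₂ (Σf≡deg u))
            (λ y py≡u → ≮⇒≥ (notLight y py≡u ∘ inj₂)) x px≡u

proposition20 :
  (D : Digraph) (C : Cover D) (f : Fin (m C) → ℕ × ℕ) →
  Connected D → DegreeFeasible C f → Uncolorable C f →
  -- (a)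
  (∀ u → fX C f u ≡ deg D u)
  ×
  -- (b)
  (∀ v (xv : Fin (m C)) u → ¬ Separating D v → p C xv ≡ v → f xv ≢ (0 , 0) → u ≢ v →
    ((∀ x → p C x ≡ u → ind (harc C x xv) ≤ proj₁ (f x))
      × sumN (inX C u) (λ x → ind (harc C x xv)) ≡ ind (arc D u v))
    ×
    ((∀ x → p C x ≡ u → ind (harc C xv x) ≤ proj₂ (f x))
      × sumN (inX C u) (λ x → ind (harc C xv x)) ≡ ind (arc D v u)))
  ×
  -- (c)
  (2 ≤ n D → ∀ u →
    (∃ λ T → PartialTransversal C T × DomAllBut C T u × StrictlyDegenerate C f T)
    ×
    (∀ T → PartialTransversal C T → DomAllBut C T u → StrictlyDegenerate C f T →
      ∀ x → p C x ≡ u → f x ≡ degIn C (addV C T x) x))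
proposition20 D C f conn feas uncol =
  fX≡deg ,
  (λ v xv u nonsep pxv≡v fxv≢0 u≢v → arcsTo nonsep pxv≡v fxv≢0 u u≢v) ,
  λ _ u →
    (let (T , tr , sd) = partialColouring u
     in T , TransversalOn⇒partial C tr , TransversalOn-∁｛｝⇒DomAllBut C tr , sd) ,
    λ T pt dom sd → f≡degIn (partial×DomAllBut⇒TransversalOn C pt dom) sd
  where open UncolorableConfiguration {D} {C} {f} conn feas uncol
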